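{- Let $R$, $\mathcal T$, $\ell$, $a$ and $d$ be as in the context, let $n\ge 0$ and let $v$ be a node of $\mathcal T$ with $\ell(v)=n$. The following are equivalent: (1) $v$ is labelled $[k]$ for some integer $k\ge 1$; (2) $v$ has no sibling to its left, and $n\ge 1$; (3) $a(n)-a(n-1)=1$; (4) $d(n)\ge 1$.
   Context: Let $R=\langle s,r_1,r_2,\ldots\rangle$ be a sequence of nonnegative integers with $s\ge 1$. Let $\Sigma=\{\mathtt r,\mathtt 0,\mathtt 1,\mathtt 2,\ldots\}$ be the infinite alphabet consisting of a letter $\mathtt r$ together with a letter $[j]$ for each integer $j\ge 0$ (so $[0]=\mathtt 0$). For a letter $\mathtt x$ and $m\ge0$, $\mathtt x^m$ is the word of $m$ copies of $\mathtt x$. Let $\sigma$ be the morphism of words over $\Sigma$ defined by $\sigma(\mathtt r)=\mathtt r\,\mathtt 0^{s}$ and $\sigma([j])=[j+1]\,\mathtt 0^{r_{j+1}}$ for $j\ge 0$. Let $\mathcal T$ be the infinite rooted ordered tree whose root is labelled $\mathtt r$ and in which the labels of the children of any node labelled $\mathtt x$, read left to right, spell $\sigma(\mathtt x)$. For a node $v$, $\ell(v)$ is the number of nodes in the same row (depth) as $v$ lying strictly to its left. Define $a:\mathbb Z\to\mathbb Z_{\ge0}$ by $a(n)=0$ for $n<0$ and $a(\ell(v))=\ell(\mathrm{parent}(v))$ for every non-root node $v$ of $\mathcal T$ (this is well defined). Let $a^0$ be the identity and $a^k$ the $k$-fold composition of $a$. For $n\ge 0$ define $d(n)=\max\{k\ge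 0: a^k(n)-a^k(n-1)=1\}$ (this maximum exists; $k=0$ always belongs to the set, and $d(0)=0$). -}

module Defs where

open import Data.Nat using (ℕ; zero; suc; _+_; _≤_; _<_)
open import Data.Integer using (ℤ; +_; _-_) renaming (_<_ to _<ℤ_)
open import Data.Fin using (Fin; toℕ)
open import Data.List using (List; []; _∷_; _++_; concatMap; length; lookup; take; map; replicate)
open import Data.Nat.ListAction using (sum)
open import Data.Product using (Σ; ∃; _×_; _,_)
open import Relation.Binary.PropositionalEquality using (_≡_)

data Letter : Set where
  𝐫   : Letter
  dig : ℕ → Letter        -- dig j is the letter [j]

iter : {A : Set} → ℕ → (A → A) → A → A
iter zero    f x = x
iter (suc k) f x = f (iter k f x)

-- The tree T determined by R = ⟨s, r₁, r₂, ...⟩.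
-- Here r j stands for r_j (j ≥ 1); the value r 0 is never used.
module Tree (s : ℕ) (r : ℕ → ℕ) where

  σ : Letter → List Letter
  σ 𝐫       = 𝐫 ∷ replicate s (dig 0)
  σ (dig j) = dig (suc j) ∷ replicate (r (suc j)) (dig 0)

  -- labels of the nodes of row (depth) k of T, read left to right:
  -- row 0 is the root, and row (k+1) is the concatenation, left to right,
  -- of the children-blocks σ(x) of the nodes x of row k.
  row : ℕ → List Letter
  row zero    = 𝐫 ∷ []
  row (suc k) = concatMap σ (row k)

  record Node : Set where
    constructor node
    field
      depth : ℕ
      pos   : Fin (length (row depth))
  open Node public

  label : Node → Letter
  label v = lookup (row (depth v)) (pos v)

  -- ℓ(v): number of nodes of the same row strictly to the left of v
  ℓ : Node → ℕ
  ℓ v = toℕ (pos v)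

  -- position in row (k+1) of the first child of the node at position i of row k
  childStart : (k : ℕ) → ℕ → ℕ
  childStart k i = sum (map (λ x → length (σ x)) (take i (row k)))

  IsParent : Node → Node → Set
  IsParent p v = (depth v ≡ suc (depth p))
               × (childStart (depth p) (ℓ p) ≤ ℓ v)
               × (ℓ v < childStart (depth p) (ℓ p) + length (σ (label p)))

  LeftSibling : Node → Node → Set
  LeftSibling w v = Σ Node λ p → IsParent p v × IsParent p w × (ℓ w < ℓ v)

  IsA : (ℤ → ℤ) → Set
  IsA a = (∀ n → n <ℤ + 0 → a n ≡ + 0)
        × (∀ p v → IsParent p v → a (+ ℓ v) ≡ + ℓ p)

  DSet : (ℤ → ℤ) → ℕ → ℕ → Set
  DSet a n k = iter k a (+ n) - iter k a (+ n - + 1) ≡ + 1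

  IsD : (ℤ → ℤ) → (ℕ → ℕ) → Set
  IsD a d = ∀ n → DSet a n (d n) × (∀ k → DSet a n k → k ≤ d n)

-- Row k+1 of the tree is the concatenation of the blocks σ(x) over the letters x of
-- row k, and a sends every position in the block of the i-th node of row k to i.
-- Every block is nonempty; its first letter is 𝐫 (for the block of the root, which
-- starts at position 0) or [j+1] (for the block of [j]), and all its other letters
-- are [0]; moreover 𝐫 occurs in a row only at position 0. Hence for n ≥ 1 the step
-- a(n) - a(n-1) is 1 exactly when n starts a block, i.e. when the node is an eldest
-- child, i.e. when it is labelled [k] with k ≥ 1, and 0 otherwise; at n = 0 it is 0
-- since a(0) = a(-1) = 0. Once a(n) = a(n-1), all further iterates of a agree at n
-- and n-1, so d(n) ≥ 1 exactly when the step is 1.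
module Submission where

open import Defs
open import Data.Nat using (ℕ; zero; suc; _+_; _≤_; _<_; _≥_; z≤n; s≤s)
open import Data.Nat.Properties
  using (≤-trans; ≤-reflexive; ≤-pred; <-trans; <⇒≱; ≰⇒>; n<1+n; n≤1+n; m≤m+n;
         +-monoʳ-≤; +-monoʳ-<; +-identityʳ; +-assoc; +-suc; m+n∸n≡m; module ≤-Reasoning)
open import Data.Integer using (ℤ; +_; -[1+_]; _-_; -<+)
open import Data.Integer.Properties using (i≡j⇒i-j≡0; [+m]-[+n]≡m⊖n; ⊖-≥)
open import Data.Fin as Fin using (Fin; toℕ)
open import Data.Fin.Properties using (toℕ<n)
open import Data.List using (List; []; _∷_; _++_; concatMap; length; lookup; take; map; replicate)
open import Data.List.Relation.Unary.All using (All; []; _∷_)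
open import Data.List.Relation.Unary.All.Properties using (++⁺; replicate⁺; concat⁺; gmap⁺)
open import Data.Nat.ListAction using (sum)
open import Data.Maybe using (Maybe; just; nothing)
open import Data.Maybe.Properties using (just-injective)
open import Data.Product as Product using (∃; _×_; _,_; proj₁; proj₂)
open import Data.Sum as Sum using (_⊎_; inj₁; inj₂)
open import Data.Empty using (⊥-elim)
open import Function using (_∘_; const)
open import Relation.Nullary using (¬_)
open import Relation.Binary.PropositionalEquality
  using (_≡_; _≢_; refl; sym; trans; cong; cong₂; subst; subst₂; module ≡-Reasoning)
open import Function.Bundles using (_⇔_; mk⇔)

private variable
  A B : Set
  P : A → Set
  x y : A
  xs ys : List A
  i j k m o : ℕ

⇔-both : A → B → A ⇔ B
⇔-both a b = mk⇔ (const b) (const a)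

⇔-neither : ¬ A → ¬ B → A ⇔ B
⇔-neither ¬a ¬b = mk⇔ (⊥-elim ∘ ¬a) (⊥-elim ∘ ¬b)

infixl 9 _!_

_!_ : List A → ℕ → Maybe A
[]       ! _     = nothing
(x ∷ xs) ! zero  = just x
(x ∷ xs) ! suc i = xs ! i

lookup-! : (xs : List A) (q : Fin (length xs)) → xs ! toℕ q ≡ just (lookup xs q)
lookup-! (x ∷ xs) Fin.zero    = refl
lookup-! (x ∷ xs) (Fin.suc q) = lookup-! xs q

!⇒lookup : (xs : List A) → xs ! i ≡ just x →
           ∃ λ (q : Fin (length xs)) → toℕ q ≡ i × lookup xs q ≡ x
!⇒lookup {i = zero}  (y ∷ ys) refl = Fin.zero , refl , refl
!⇒lookup {i = suc i} (y ∷ ys) e    =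
  Product.map Fin.suc (Product.map₁ (cong suc)) (!⇒lookup ys e)

<⇒!-just : (xs : List A) → i < length xs → ∃ λ x → xs ! i ≡ just x
<⇒!-just {i = zero}  (x ∷ xs) _       = x , refl
<⇒!-just {i = suc i} (x ∷ xs) (s≤s h) = <⇒!-just xs h

!-pred : (xs : List A) → xs ! suc i ≡ just x → ∃ λ y → xs ! i ≡ just y
!-pred {i = zero}  (y ∷ _)  _ = y , refl
!-pred {i = suc i} (_ ∷ ys) e = !-pred ys e

!-++ˡ : (xs : List A) → i < length xs → (xs ++ ys) ! i ≡ xs ! i
!-++ˡ {i = zero}  (x ∷ xs) _       = refl
!-++ˡ {i = suc i} (x ∷ xs) (s≤s h) = !-++ˡ xs h

!-++ʳ : (xs : List A) → (xs ++ ys) ! (length xs + i) ≡ ys ! i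
!-++ʳ []       = refl
!-++ʳ (x ∷ xs) = !-++ʳ xs

All-! : All P xs → xs ! i ≡ just x → P x
All-! {i = zero}  (px ∷ _)   refl = px
All-! {i = suc i} (_  ∷ pxs) e    = All-! pxs e

++-position : (xs : List A) → m < length (xs ++ ys) →
              m < length xs ⊎ ∃ λ m′ → m′ < length ys × m ≡ length xs + m′
++-position []                  h       = inj₂ (_ , h , refl)
++-position {m = zero}  (x ∷ xs) _       = inj₁ (s≤s z≤n)
++-position {m = suc m} (x ∷ xs) (s≤s h) =
  Sum.map s≤s (Product.map₂ (Product.map₂ (cong suc))) (++-position xs h)

module _ (f : A → List B) where

  blockStart : List A → ℕ → ℕ
  blockStart xs i = sum (map (λ x → length (f x)) (take i xs))

  blockStart-suc : (xs : List A) → xs ! i ≡ just x →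
                   blockStart xs (suc i) ≡ blockStart xs i + length (f x)
  blockStart-suc {i = zero}  (y ∷ ys) refl = +-identityʳ (length (f y))
  blockStart-suc {i = suc i} (y ∷ ys) e    =
    trans (cong (_+_ (length (f y))) (blockStart-suc ys e)) (sym (+-assoc (length (f y)) _ _))

  blockStart-mono-≤ : (xs : List A) → i ≤ j → blockStart xs i ≤ blockStart xs j
  blockStart-mono-≤ {i = zero}              _        _       = z≤n
  blockStart-mono-≤ {i = suc i} {j = suc j} []       _       = z≤n
  blockStart-mono-≤ {i = suc i} {j = suc j} (y ∷ ys) (s≤s h) =
    +-monoʳ-≤ (length (f y)) (blockStart-mono-≤ ys h)

  blockStart-cancel-< : (xs : List A) → blockStart xs i < blockStart xs j → i < j
  blockStart-cancel-< xs h = ≰⇒> (<⇒≱ h ∘ blockStart-mono-≤ xs)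

  concatMap-! : (xs : List A) → xs ! i ≡ just x → o < length (f x) →
                concatMap f xs ! (blockStart xs i + o) ≡ f x ! o
  concatMap-! {i = zero}                  (y ∷ ys) refl h = !-++ˡ (f y) h
  concatMap-! {i = suc i} {x = x} {o = o} (y ∷ ys) e    h = begin
    (f y ++ concatMap f ys) ! ((length (f y) + blockStart ys i) + o)
      ≡⟨ cong ((f y ++ concatMap f ys) !_) (+-assoc (length (f y)) _ o) ⟩
    (f y ++ concatMap f ys) ! (length (f y) + (blockStart ys i + o))
      ≡⟨ !-++ʳ (f y) ⟩
    concatMap f ys ! (blockStart ys i + o)
      ≡⟨ concatMap-! ys e h ⟩
    f x ! o ∎
    where open ≡-Reasoning

  concatMap-block : (xs : List A) → m < length (concatMap f xs) →
    ∃ λ i → ∃ λ x → ∃ λ o → xs ! i ≡ just x × o < length (f x) × m ≡ blockStart xs i + o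
  concatMap-block (y ∷ ys) h with ++-position (f y) h
  ... | inj₁ m<               = 0 , y , _ , refl , m< , refl
  ... | inj₂ (m′ , h′ , refl) with concatMap-block ys h′
  ...   | i , x , o , e , o< , refl = suc i , x , o , e , o< , sym (+-assoc (length (f y)) _ o)

iter-suc-cong : (f : A → A) → f x ≡ f y → ∀ k → iter (suc k) f x ≡ iter (suc k) f y
iter-suc-cong f e zero    = e
iter-suc-cong f e (suc k) = cong f (iter-suc-cong f e k)

x≡y⇒x-y≢1 : {x y : ℤ} → x ≡ y → x - y ≢ + 1
x≡y⇒x-y≢1 x≡y x-y≡1 with trans (sym (i≡j⇒i-j≡0 x≡y)) x-y≡1
... | ()

[1+n]-n≡1 : ∀ n → + suc n - + n ≡ + 1
[1+n]-n≡1 n = trans ([+m]-[+n]≡m⊖n (suc n) n) (trans (⊖-≥ (n≤1+n n)) (cong +_ (m+n∸n≡m 1 n)))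

dig-positive≢dig0 : j ≥ 1 → dig j ≢ dig 0
dig-positive≢dig0 () refl

UnitStep : (ℤ → ℤ) → ℕ → Set
UnitStep a n = a (+ n) - a (+ n - + 1) ≡ + 1

FlatStep : (ℤ → ℤ) → ℕ → Set
FlatStep a n = a (+ n) ≡ a (+ n - + 1)

module _ (s : ℕ) (r : ℕ → ℕ) where
  open Tree s r

  IsDigit : Letter → Set
  IsDigit x = ∃ λ j → x ≡ dig j

  σ-digits : IsDigit x → All IsDigit (σ x)
  σ-digits (j , refl) = (suc j , refl) ∷ replicate⁺ (r (suc j)) (0 , refl)

  σ-nonempty : ∀ x → ∃ λ c → length (σ x) ≡ suc c
  σ-nonempty 𝐫       = _ , refl
  σ-nonempty (dig j) = _ , refl

  σ-tail : ∀ x → σ x ! suc o ≡ just y → y ≡ dig 0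
  σ-tail 𝐫       = All-! (replicate⁺ {P = _≡ dig 0} s refl)
  σ-tail (dig j) = All-! (replicate⁺ {P = _≡ dig 0} (r (suc j)) refl)

  row-shape : ∀ k → ∃ λ rest → row k ≡ 𝐫 ∷ rest × All IsDigit rest
  row-shape zero    = [] , refl , []
  row-shape (suc k) with row-shape k
  ... | rest , e , digits =
    replicate s (dig 0) ++ concatMap σ rest , cong (concatMap σ) e ,
    ++⁺ (replicate⁺ s (0 , refl)) (concat⁺ (gmap⁺ σ-digits digits))

  row-!-zero : ∀ k → row k ! 0 ≡ just 𝐫
  row-!-zero k with row-shape k
  ... | _ , e , _ = cong (_! 0) e

  row-!-suc : ∀ k → row k ! suc i ≡ just x → IsDigit x
  row-!-suc k h with row-shape k
  ... | _ , e , digits = All-! digits (trans (cong (_! _) (sym e)) h)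

  label-leftmost : ∀ k (q : Fin (length (row k))) → toℕ q ≡ 0 → label (node k q) ≡ 𝐫
  label-leftmost k q q≡0 = just-injective (begin
    just (lookup (row k) q) ≡⟨ lookup-! (row k) q ⟨
    row k ! toℕ q           ≡⟨ cong (row k !_) q≡0 ⟩
    row k ! 0               ≡⟨ row-!-zero k ⟩
    just 𝐫                  ∎)
    where open ≡-Reasoning

  child-position : ∀ k → row k ! i ≡ just x → o < length (σ x) →
                   ∃ λ (q : Fin (length (row (suc k)))) → toℕ q ≡ childStart k i + o
  child-position {x = x} k e o< with <⇒!-just (σ x) o<
  ... | _ , σx!o =
    Product.map₂ proj₁ (!⇒lookup (row (suc k)) (trans (concatMap-! σ (row k) e o<) σx!o))

  child-label : ∀ k → row k ! i ≡ just x → o < length (σ x) → (q : Fin (length (row (suc k)))) →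
                toℕ q ≡ childStart k i + o → σ x ! o ≡ just (label (node (suc k) q))
  child-label {i = i} {x = x} {o = o} k e o< q q≡ = begin
    σ x ! o                            ≡⟨ concatMap-! σ (row k) e o< ⟨
    row (suc k) ! (childStart k i + o) ≡⟨ cong (row (suc k) !_) q≡ ⟨
    row (suc k) ! toℕ q                ≡⟨ lookup-! (row (suc k)) q ⟩
    just (lookup (row (suc k)) q)      ∎
    where open ≡-Reasoning

  last-child-offset : ∀ k → row k ! i ≡ just x →
                      ∃ λ c → c < length (σ x) × childStart k (suc i) ≡ suc (childStart k i + c)
  last-child-offset {i = i} {x = x} k e with σ-nonempty x
  ... | c , |σx| = c , subst (c <_) (sym |σx|) (n<1+n c) , (begin
    childStart k (suc i)          ≡⟨ blockStart-suc σ (row k) e ⟩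
    childStart k i + length (σ x) ≡⟨ cong (_+_ (childStart k i)) |σx| ⟩
    childStart k i + suc c        ≡⟨ +-suc _ c ⟩
    suc (childStart k i + c)      ∎)
    where open ≡-Reasoning

  isParent-block : ∀ k (p : Fin (length (row k))) (q : Fin (length (row (suc k)))) →
                   o < length (σ (lookup (row k) p)) → toℕ q ≡ childStart k (toℕ p) + o →
                   IsParent (node k p) (node (suc k) q)
  isParent-block k p q o< q≡ =
    refl , ≤-trans (m≤m+n _ _) (≤-reflexive (sym q≡)) , subst (_< _) (sym q≡) (+-monoʳ-< _ o<)

  first-child-no-left-sibling : ∀ k (q : Fin (length (row (suc k)))) → toℕ q ≡ childStart k j →
                                ¬ ∃ λ w → LeftSibling w (node (suc k) q)
  first-child-no-left-sibling {j = j} k q q≡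
    (w , node .k p , (refl , _ , q<end) , (_ , start≤w , _) , w<q) = <⇒≱ w<q (begin
      toℕ q                ≡⟨ q≡ ⟩
      childStart k j       ≤⟨ blockStart-mono-≤ σ (row k) j≤p ⟩
      childStart k (toℕ p) ≤⟨ start≤w ⟩
      toℕ (pos w)          ∎)
    where
    open ≤-Reasoning
    j≤p : j ≤ toℕ p
    j≤p = ≤-pred (blockStart-cancel-< σ (row k) (begin-strict
      childStart k j                                       ≡⟨ q≡ ⟨
      toℕ q                                                <⟨ q<end ⟩
      childStart k (toℕ p) + length (σ (lookup (row k) p)) ≡⟨ blockStart-suc σ (row k) (lookup-! (row k) p) ⟨
      childStart k (suc (toℕ p))                           ∎))

  module _ (a : ℤ → ℤ) (isA : IsA a) where

    PositiveDigitLabel : Node → Set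
    PositiveDigitLabel v = ∃ λ k → (k ≥ 1) × (label v ≡ dig k)

    NoLeftSibling : Node → Set
    NoLeftSibling v = ¬ (∃ λ w → LeftSibling w v)

    AllHold NoneHold : Node → Set
    AllHold  v = PositiveDigitLabel v × (NoLeftSibling v × ℓ v ≥ 1) × UnitStep a (ℓ v)
    NoneHold v = ¬ PositiveDigitLabel v × ¬ (NoLeftSibling v × ℓ v ≥ 1) × FlatStep a (ℓ v)

    a-block : ∀ k → row k ! i ≡ just x → o < length (σ x) → a (+ (childStart k i + o)) ≡ + i
    a-block k e o< with !⇒lookup (row k) e
    ... | p , refl , refl with child-position k e o<
    ...   | q , q≡ = subst (λ m → a (+ m) ≡ + toℕ p) q≡
                       (proj₂ isA (node k p) (node (suc k) q) (isParent-block k p q o< q≡))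

    leftmost : (v : Node) → ℓ v ≡ 0 → NoneHold v
    leftmost (node k q) q≡0 = ¬positive , ¬eldest , subst (FlatStep a) (sym q≡0) flat
      where
      ¬positive : ¬ PositiveDigitLabel (node k q)
      ¬positive (j , _ , lv) with trans (sym (label-leftmost k q q≡0)) lv
      ... | ()
      ¬eldest : ¬ (NoLeftSibling (node k q) × toℕ q ≥ 1)
      ¬eldest (_ , 1≤q) with subst (1 ≤_) q≡0 1≤q
      ... | ()
      flat : FlatStep a 0
      flat = trans (a-block 0 refl (s≤s z≤n)) (sym (proj₁ isA -[1+ 0 ] -<+))

    later-child : ∀ k → row k ! i ≡ just x → suc o < length (σ x) →
                  (q : Fin (length (row (suc k)))) → toℕ q ≡ childStart k i + suc o →
                  NoneHold (node (suc k) q)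
    later-child {i = i} {x = x} {o = o} k e 1+o< q q≡ with !⇒lookup (row k) e
    ... | p , refl , refl = ¬positive , ¬eldest , flat
      where
      o< : o < length (σ x)
      o< = <-trans (n<1+n o) 1+o<
      ¬positive : ¬ PositiveDigitLabel (node (suc k) q)
      ¬positive (j , j≥1 , lv) =
        dig-positive≢dig0 j≥1 (trans (sym lv) (σ-tail x (child-label k e 1+o< q q≡)))
      ¬eldest : ¬ (NoLeftSibling (node (suc k) q) × toℕ q ≥ 1)
      ¬eldest (none , _) with child-position k e o<
      ... | w , w≡ = none (node (suc k) w , node k p ,
                           isParent-block k p q 1+o< q≡ , isParent-block k p w o< w≡ ,
                           subst₂ _<_ (sym w≡) (sym q≡) (+-monoʳ-< _ (n<1+n o)))
      -- The last step uses that + suc n - + 1 reduces to + n.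
      flat : FlatStep a (toℕ q)
      flat = begin
        a (+ toℕ q)                    ≡⟨ cong (a ∘ +_) q≡ ⟩
        a (+ (childStart k i + suc o)) ≡⟨ a-block k e 1+o< ⟩
        + i                            ≡⟨ a-block k e o< ⟨
        a (+ (childStart k i + o))     ≡⟨ cong (λ n → a (+ n - + 1)) (trans (sym (+-suc _ o)) (sym q≡)) ⟩
        a (+ toℕ q - + 1)              ∎
        where open ≡-Reasoning

    first-child : ∀ k → row k ! suc i ≡ just x → (q : Fin (length (row (suc k)))) →
                  toℕ q ≡ childStart k (suc i) → AllHold (node (suc k) q)
    first-child {i = i} k e q q≡ with row-!-suc k e | !-pred (row k) e
    ... | j , refl | _ , e′ with last-child-offset k e′
    ...   | c , c< , start≡ =
      positive , (first-child-no-left-sibling {j = suc i} k q q≡ , 1≤q) , unit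
      where
      q≡′ : toℕ q ≡ suc (childStart k i + c)
      q≡′ = trans q≡ start≡
      1≤q : toℕ q ≥ 1
      1≤q = subst (_≥ 1) (sym q≡′) (s≤s z≤n)
      q≡+0 : toℕ q ≡ childStart k (suc i) + 0
      q≡+0 = trans q≡ (sym (+-identityʳ _))
      positive : PositiveDigitLabel (node (suc k) q)
      positive = suc j , s≤s z≤n , sym (just-injective (child-label k e (s≤s z≤n) q q≡+0))
      unit : UnitStep a (toℕ q)
      unit = begin
        a (+ toℕ q) - a (+ toℕ q - + 1)
          ≡⟨ cong₂ _-_ (trans (cong (a ∘ +_) q≡+0) (a-block k e (s≤s z≤n)))
                       (trans (cong (λ n → a (+ n - + 1)) q≡′) (a-block k e′ c<)) ⟩
        + suc i - + i
          ≡⟨ [1+n]-n≡1 i ⟩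
        + 1 ∎
        where open ≡-Reasoning

    classify : (v : Node) → NoneHold v ⊎ AllHold v
    classify (node zero Fin.zero) = inj₁ (leftmost _ refl)
    classify (node (suc k) q) with concatMap-block σ (row k) (toℕ<n q)
    ... | zero  , _ , zero  , _ , _  , q≡ = inj₁ (leftmost _ q≡)
    ... | suc i , _ , zero  , e , _  , q≡ = inj₂ (first-child k e q (trans q≡ (+-identityʳ _)))
    ... | _     , _ , suc o , e , o< , q≡ = inj₁ (later-child k e o< q q≡)

  flat⇒¬d≥1 : {a : ℤ → ℤ} {d : ℕ → ℕ} → IsD a d → FlatStep a m → ¬ d m ≥ 1
  flat⇒¬d≥1 {m = m} {a} {d} isD flat with d m | proj₁ (isD m)
  ... | zero  | _    = λ ()
  ... | suc k | dset = λ _ → x≡y⇒x-y≢1 (iter-suc-cong a flat k) dset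

lemma7 : (s : ℕ) → s ≥ 1 → (r : ℕ → ℕ) →
    let open Tree s r in
    (a : ℤ → ℤ) → IsA a → (d : ℕ → ℕ) → IsD a d →
    (n : ℕ) (v : Node) → ℓ v ≡ n →
    let P1 = ∃ λ k → (k ≥ 1) × (label v ≡ dig k)
        P2 = (¬ (∃ λ w → LeftSibling w v)) × (n ≥ 1)
        P3 = a (+ n) - a (+ n - + 1) ≡ + 1
        P4 = d n ≥ 1
    in (P1 ⇔ P2) × (P1 ⇔ P3) × (P1 ⇔ P4)
lemma7 s _ r a isA d isD _ v refl with classify s r a isA v
... | inj₁ (¬p1 , ¬p2 , flat) =
  ⇔-neither ¬p1 ¬p2 , ⇔-neither ¬p1 (x≡y⇒x-y≢1 flat) , ⇔-neither ¬p1 (flat⇒¬d≥1 s r isD flat)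
... | inj₂ (p1 , p2 , unit) =
  ⇔-both p1 p2 , ⇔-both p1 unit , ⇔-both p1 (proj₂ (isD _) 1 unit)
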